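{- Let $G$ and $H$ be graphs, where $G$ has order $n$. If $H=K_1$, then $\gamma_{\{R2\}}(G[H])=n+\gamma(G)$; otherwise $\gamma_{\{R2\}}(G[H])=2n$.
   Context: All graphs are finite and simple. A Roman $\{2\}$-dominating function on a graph $G=(V,E)$ is a function $f:V\to\{0,1,2\}$ such that for every vertex $v$ with $f(v)=0$, $\sum_{u\in N(v)}f(u)\geq 2$. Its weight is $\sum_{v\in V}f(v)$, and $\gamma_{\{R2\}}(G)$ is the minimum weight of such a function. $\gamma(G)$ is the domination number. The corona $G[H]$ is constructed as follows: label the vertices of $G$ as $1,\dots,n$; take one copy of $G$ and $n$ disjoint copies $H_1,\dots,H_n$ of $H$, and join every vertex of $H_i$ to vertex $i$ of $G$. -}

module Defs where

open import Data.Nat using (ℕ; zero; suc; _+_; _*_; _≤_)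
open import Data.Fin using (Fin; splitAt; remQuot; _≟_)
open import Data.Bool using (Bool; true; false; if_then_else_; _∧_)
open import Data.Sum using (_⊎_; inj₁; inj₂)
open import Data.Product using (_×_; _,_; Σ)
open import Data.List using (List; map; allFin)
open import Data.Nat.ListAction using (sum)
open import Relation.Nullary.Decidable using (⌊_⌋)
open import Relation.Binary.PropositionalEquality using (_≡_)

record Graph (n : ℕ) : Set where
  field
    adj    : Fin n → Fin n → Bool
    symm   : ∀ u v → adj u v ≡ adj v u
    irrefl : ∀ v → adj v v ≡ false
open Graph public

Σv : {n : ℕ} → (Fin n → ℕ) → ℕ
Σv {n} g = sum (map g (allFin n))

-- Sum of f over the open neighbourhood N(v).
-- (taken over a raw adjacency function so it applies to constructed graphs)
nbrSum : {n : ℕ} → (Fin n → Fin n → Bool) → (Fin n → ℕ) → Fin n → ℕ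
nbrSum A f v = Σv (λ u → if A v u then f u else 0)

data Val : Set where
  v0 v1 v2 : Val

val : Val → ℕ
val v0 = 0
val v1 = 1
val v2 = 2

IsR2DF : {n : ℕ} → (Fin n → Fin n → Bool) → (Fin n → Val) → Set
IsR2DF G f = ∀ v → f v ≡ v0 → 2 ≤ nbrSum G (λ u → val (f u)) v

weight : {n : ℕ} → (Fin n → Val) → ℕ
weight f = Σv (λ v → val (f v))

IsR2Number : {n : ℕ} → (Fin n → Fin n → Bool) → ℕ → Set
IsR2Number G k =
  Σ _ (λ f → IsR2DF G f × weight f ≡ k) ×
  (∀ f → IsR2DF G f → k ≤ weight f)

ind : Bool → ℕ
ind true  = 1
ind false = 0

IsDominating : {n : ℕ} → (Fin n → Fin n → Bool) → (Fin n → Bool) → Set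
IsDominating G S = ∀ v → S v ≡ false → 1 ≤ nbrSum G (λ u → ind (S u)) v

card : {n : ℕ} → (Fin n → Bool) → ℕ
card S = Σv (λ v → ind (S v))

IsDomNumber : {n : ℕ} → (Fin n → Fin n → Bool) → ℕ → Set
IsDomNumber G k =
  Σ _ (λ S → IsDominating G S × card S ≡ k) ×
  (∀ S → IsDominating G S → k ≤ card S)

-- Corona G[H]: vertices Fin (n + n * m); the first n are the copy of G,
-- vertex (i , h) (via remQuot) is vertex h of the copy H_i.
coronaAdj : {n m : ℕ} → Graph n → Graph m →
            Fin (n + n * m) → Fin (n + n * m) → Bool
coronaAdj {n} {m} G H x y with splitAt n x | splitAt n y
... | inj₁ i | inj₁ j = adj G i j
... | inj₁ i | inj₂ q with remQuot {n} m q
...   | (j , _) = ⌊ i ≟ j ⌋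
coronaAdj {n} {m} G H x y | inj₂ p | inj₁ j with remQuot {n} m p
...   | (i , _) = ⌊ i ≟ j ⌋
coronaAdj {n} {m} G H x y | inj₂ p | inj₂ q with remQuot {n} m p | remQuot {n} m q
...   | (i , h) | (j , h') = ⌊ i ≟ j ⌋ ∧ adj H h h'

-- Group the vertices of G[H] into n blocks: vertex i of G together with the copy H_i.
-- The neighbourhood of a vertex of H_i lies inside block i, so a block in which f
-- vanishes somewhere on H_i has weight at least 2.
--
-- If H has at least two vertices, every block therefore has weight at least 2 (either
-- f vanishes on H_i or H_i already carries two positive values), and f = 2 on G,
-- 0 elsewhere attains 2n.
--
-- If H = K₁, let S be the set of blocks not labelled 0 on G and 1 on the leaf.  Every
-- block has weight at least 1, and blocks in S at least 2, so the weight is at least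
-- n + |S|.  S dominates G: for i ∉ S the vertex i has value 0 and its leaf only gives 1,
-- so some G-neighbour j has f(j) > 0, and then j ∈ S.  Conversely, a dominating set D
-- yields f = 2 on D and 1 on the leaves of the other vertices, of weight n + |D|.
module Submission where

open import Defs
open import Data.Nat using (ℕ; zero; suc; _+_; _*_; _≤_; z≤n; s≤s)
open import Data.Nat.Properties
  using (≤-refl; ≤-reflexive; ≤-trans; +-mono-≤; +-monoˡ-≤; +-monoʳ-≤; m≤m+n; m≤n+m;
         +-assoc; +-identityʳ; *-comm; *-identityʳ; *-zeroʳ; +-*-semiring; module ≤-Reasoning)
open import Data.Fin
  using (Fin; zero; suc; splitAt; remQuot; combine; join; _↑ˡ_; _↑ʳ_; _≟_)
open import Data.Fin.Properties
  using (splitAt-↑ˡ; splitAt-↑ʳ; join-splitAt; remQuot-combine; combine-remQuot)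
open import Data.Bool using (Bool; true; false; if_then_else_; _∧_)
open import Data.Sum using (_⊎_; inj₁; inj₂; [_,_]′)
open import Data.Product using (_×_; _,_; ∃; ∃₂; proj₁; proj₂; uncurry)
open import Data.List using (tabulate)
open import Data.List.Properties using (map-tabulate)
import Data.Nat.ListAction as List
open import Relation.Nullary using (¬_; contradiction)
open import Relation.Nullary.Decidable using (⌊_⌋; ⌊⌋-map′)
open import Relation.Binary.PropositionalEquality
open import Function using (_∘_; id)
open import Algebra.Properties.Semiring.Sum +-*-semiring
  using (sum; sum-syntax; sum-cong-≗; sum-replicate-zero; ∑-distrib-+; *-distribˡ-sum)

Σv≡sum : ∀ {n} (g : Fin n → ℕ) → Σv g ≡ sum g
Σv≡sum g = trans (cong List.sum (map-tabulate id g)) (sum-tabulate g)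
  where
  sum-tabulate : ∀ {k} (g : Fin k → ℕ) → List.sum (tabulate g) ≡ sum g
  sum-tabulate {zero}  g = refl
  sum-tabulate {suc k} g = cong (g zero +_) (sum-tabulate (g ∘ suc))

sum-mono-≤ : ∀ {n} {g h : Fin n → ℕ} → (∀ i → g i ≤ h i) → sum g ≤ sum h
sum-mono-≤ {zero}  g≤h = z≤n
sum-mono-≤ {suc n} g≤h = +-mono-≤ (g≤h zero) (sum-mono-≤ (g≤h ∘ suc))

sum-const : ∀ n c → ∑[ i < n ] c ≡ n * c
sum-const zero    c = refl
sum-const (suc n) c = cong (c +_) (sum-const n c)

sum-↑ : ∀ a b (g : Fin (a + b) → ℕ) →
        sum g ≡ ∑[ i < a ] g (i ↑ˡ b) + ∑[ j < b ] g (a ↑ʳ j)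
sum-↑ zero    b g = refl
sum-↑ (suc a) b g =
  trans (cong (g zero +_) (sum-↑ a b (g ∘ suc))) (sym (+-assoc (g zero) _ _))

sum-combine : ∀ n m (g : Fin (n * m) → ℕ) →
              sum g ≡ ∑[ i < n ] ∑[ j < m ] g (combine i j)
sum-combine zero    m g = refl
sum-combine (suc n) m g = trans (sum-↑ m (n * m) g)
  (cong (∑[ j < m ] g (j ↑ˡ (n * m)) +_) (sum-combine n m (g ∘ (m ↑ʳ_))))

sum-if : ∀ {n} b (g : Fin n → ℕ) →
         ∑[ i < n ] (if b then g i else 0) ≡ (if b then sum g else 0)
sum-if     true  g = refl
sum-if {n} false g = sum-replicate-zero n

sum-if-≟ : ∀ {n} (i : Fin n) (g : Fin n → ℕ) →
           ∑[ j < n ] (if ⌊ i ≟ j ⌋ then g j else 0) ≡ g i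
sum-if-≟ {suc n} zero    g = trans (cong (g zero +_) (sum-replicate-zero n)) (+-identityʳ _)
sum-if-≟ {suc n} (suc i) g = trans
  (sum-cong-≗ λ j → cong (λ b → if b then g (suc j) else 0) (⌊⌋-map′ _ _ (i ≟ j)))
  (sum-if-≟ i (g ∘ suc))

sum-1+ind≡n+card : ∀ {n} (S : Fin n → Bool) → ∑[ i < n ] (1 + ind (S i)) ≡ n + card S
sum-1+ind≡n+card {n} S = begin
  ∑[ i < n ] (1 + ind (S i))            ≡⟨ ∑-distrib-+ (λ _ → 1) (ind ∘ S) ⟩
  ∑[ i < n ] 1 + ∑[ i < n ] ind (S i)   ≡⟨ cong₂ _+_ (trans (sum-const n 1) (*-identityʳ n))
                                                     (sym (Σv≡sum (ind ∘ S))) ⟩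
  n + card S                            ∎
  where open ≡-Reasoning

module _ {n : ℕ} (A : Fin n → Fin n → Bool) where

  nbrSum≡sum : ∀ g v → nbrSum A g v ≡ ∑[ u < n ] (if A v u then g u else 0)
  nbrSum≡sum g v = Σv≡sum (λ u → if A v u then g u else 0)

  nbrSum≤sum : ∀ g v → nbrSum A g v ≤ sum g
  nbrSum≤sum g v = begin
    nbrSum A g v                           ≡⟨ nbrSum≡sum _ v ⟩
    ∑[ u < n ] (if A v u then g u else 0)  ≤⟨ sum-mono-≤ (λ u → if-≤ (A v u)) ⟩
    sum g                                  ∎
    where
    open ≤-Reasoning
    if-≤ : ∀ b {x} → (if b then x else 0) ≤ x
    if-≤ true  = ≤-refl
    if-≤ false = z≤n

  nbrSum-mono : ∀ {g h : Fin n → ℕ} → (∀ u → g u ≤ h u) →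
                ∀ v → nbrSum A g v ≤ nbrSum A h v
  nbrSum-mono {g} {h} g≤h v = begin
    nbrSum A g v                           ≡⟨ nbrSum≡sum _ v ⟩
    ∑[ u < n ] (if A v u then g u else 0)  ≤⟨ sum-mono-≤ (λ u → if-mono (A v u) (g≤h u)) ⟩
    ∑[ u < n ] (if A v u then h u else 0)  ≡⟨ nbrSum≡sum _ v ⟨
    nbrSum A h v                           ∎
    where
    open ≤-Reasoning
    if-mono : ∀ b {x y} → x ≤ y → (if b then x else 0) ≤ (if b then y else 0)
    if-mono true  x≤y = x≤y
    if-mono false _   = z≤n

  nbrSum-scale : ∀ c (g : Fin n → ℕ) v → nbrSum A (λ u → c * g u) v ≡ c * nbrSum A g v
  nbrSum-scale c g v = begin
    nbrSum A (λ u → c * g u) v                   ≡⟨ nbrSum≡sum _ v ⟩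
    ∑[ u < n ] (if A v u then c * g u else 0)    ≡⟨ sum-cong-≗ (λ u → if-* (A v u)) ⟩
    ∑[ u < n ] (c * (if A v u then g u else 0))
      ≡⟨ *-distribˡ-sum c (λ u → if A v u then g u else 0) ⟨
    c * ∑[ u < n ] (if A v u then g u else 0)    ≡⟨ cong (c *_) (nbrSum≡sum g v) ⟨
    c * nbrSum A g v                             ∎
    where
    open ≡-Reasoning
    if-* : ∀ b {x} → (if b then c * x else 0) ≡ c * (if b then x else 0)
    if-* true  = refl
    if-* false = sym (*-zeroʳ c)

module Corona {n m : ℕ} (G : Graph n) (H : Graph m) where

  A : Fin (n + n * m) → Fin (n + n * m) → Bool
  A = coronaAdj G H

  inG : Fin n → Fin (n + n * m)
  inG i = i ↑ˡ (n * m)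

  inH : Fin n → Fin m → Fin (n + n * m)
  inH i h = n ↑ʳ combine i h

  adj-inG-inG : ∀ i j → A (inG i) (inG j) ≡ adj G i j
  adj-inG-inG i j rewrite splitAt-↑ˡ n i (n * m) | splitAt-↑ˡ n j (n * m) = refl

  adj-inG-inH : ∀ i j h → A (inG i) (inH j h) ≡ ⌊ i ≟ j ⌋
  adj-inG-inH i j h
    rewrite splitAt-↑ˡ n i (n * m) | splitAt-↑ʳ n (n * m) (combine j h)
    = cong (λ p → ⌊ i ≟ proj₁ p ⌋) (remQuot-combine j h)

  adj-inH-inG : ∀ i h j → A (inH i h) (inG j) ≡ ⌊ i ≟ j ⌋
  adj-inH-inG i h j
    rewrite splitAt-↑ʳ n (n * m) (combine i h) | splitAt-↑ˡ n j (n * m)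
    = cong (λ p → ⌊ proj₁ p ≟ j ⌋) (remQuot-combine i h)

  adj-inH-inH : ∀ i h j h′ → A (inH i h) (inH j h′) ≡ ⌊ i ≟ j ⌋ ∧ adj H h h′
  adj-inH-inH i h j h′
    rewrite splitAt-↑ʳ n (n * m) (combine i h) | splitAt-↑ʳ n (n * m) (combine j h′)
    = cong₂ (λ p p′ → ⌊ proj₁ p ≟ proj₁ p′ ⌋ ∧ adj H (proj₂ p) (proj₂ p′))
            (remQuot-combine i h) (remQuot-combine j h′)

  vertex-cases : ∀ x → (∃ λ i → x ≡ inG i) ⊎ (∃₂ λ i h → x ≡ inH i h)
  vertex-cases x with splitAt n x in eq
  ... | inj₁ i = inj₁ (i , trans (sym (join-splitAt n (n * m) x)) (cong (join n (n * m)) eq))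
  ... | inj₂ q = inj₂ (proj₁ (remQuot {n} m q) , proj₂ (remQuot {n} m q) ,
                       trans (sym (join-splitAt n (n * m) x))
                             (trans (cong (join n (n * m)) eq)
                                    (cong (n ↑ʳ_) (sym (combine-remQuot {n} m q)))))

  corona-rec : {X : Set} → (Fin n → X) → (Fin n → Fin m → X) → Fin (n + n * m) → X
  corona-rec g k x = [ g , uncurry k ∘ remQuot m ]′ (splitAt n x)

  corona-rec-inG : ∀ {X : Set} (g : Fin n → X) k i → corona-rec g k (inG i) ≡ g i
  corona-rec-inG g k i rewrite splitAt-↑ˡ n i (n * m) = refl

  corona-rec-inH : ∀ {X : Set} (g : Fin n → X) k i h → corona-rec g k (inH i h) ≡ k i h
  corona-rec-inH g k i h
    rewrite splitAt-↑ʳ n (n * m) (combine i h) = cong (uncurry k) (remQuot-combine i h)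

  Σv-corona : (g : Fin (n + n * m) → ℕ) →
              Σv g ≡ ∑[ i < n ] g (inG i) + ∑[ i < n ] ∑[ h < m ] g (inH i h)
  Σv-corona g = trans (Σv≡sum g) (trans (sum-↑ n (n * m) g)
    (cong (∑[ i < n ] g (inG i) +_) (sum-combine n m (g ∘ (n ↑ʳ_)))))

  nbrSum-inG : ∀ g i →
               nbrSum A g (inG i) ≡ nbrSum (adj G) (g ∘ inG) i + ∑[ h < m ] g (inH i h)
  nbrSum-inG g i = begin
    nbrSum A g (inG i)
      ≡⟨ Σv-corona _ ⟩
    ∑[ j < n ] (if A (inG i) (inG j) then g (inG j) else 0)
      + ∑[ j < n ] ∑[ h < m ] (if A (inG i) (inH j h) then g (inH j h) else 0)
      ≡⟨ cong₂ _+_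
           (sum-cong-≗ λ j → cong (λ b → if b then g (inG j) else 0) (adj-inG-inG i j))
           (sum-cong-≗ λ j → trans
             (sum-cong-≗ λ h →
               cong (λ b → if b then g (inH j h) else 0) (adj-inG-inH i j h))
             (sum-if ⌊ i ≟ j ⌋ (g ∘ inH j))) ⟩
    ∑[ j < n ] (if adj G i j then g (inG j) else 0)
      + ∑[ j < n ] (if ⌊ i ≟ j ⌋ then ∑[ h < m ] g (inH j h) else 0)
      ≡⟨ cong₂ _+_ (sym (nbrSum≡sum (adj G) (g ∘ inG) i))
                   (sum-if-≟ i (λ j → ∑[ h < m ] g (inH j h))) ⟩
    nbrSum (adj G) (g ∘ inG) i + ∑[ h < m ] g (inH i h) ∎
    where open ≡-Reasoning

  nbrSum-inH : ∀ g i h → nbrSum A g (inH i h) ≡ g (inG i) + nbrSum (adj H) (g ∘ inH i) h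
  nbrSum-inH g i h = begin
    nbrSum A g (inH i h)
      ≡⟨ Σv-corona _ ⟩
    ∑[ j < n ] (if A (inH i h) (inG j) then g (inG j) else 0)
      + ∑[ j < n ] ∑[ h′ < m ] (if A (inH i h) (inH j h′) then g (inH j h′) else 0)
      ≡⟨ cong₂ _+_
           (sum-cong-≗ λ j → cong (λ b → if b then g (inG j) else 0) (adj-inH-inG i h j))
           (sum-cong-≗ λ j → trans
             (sum-cong-≗ λ h′ → trans
               (cong (λ b → if b then g (inH j h′) else 0) (adj-inH-inH i h j h′))
               (if-∧ ⌊ i ≟ j ⌋ (adj H h h′)))
             (sum-if ⌊ i ≟ j ⌋ (λ h′ → if adj H h h′ then g (inH j h′) else 0))) ⟩
    ∑[ j < n ] (if ⌊ i ≟ j ⌋ then g (inG j) else 0)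
      + ∑[ j < n ] (if ⌊ i ≟ j ⌋
                      then ∑[ h′ < m ] (if adj H h h′ then g (inH j h′) else 0) else 0)
      ≡⟨ cong₂ _+_ (sum-if-≟ i (g ∘ inG))
                   (sum-if-≟ i (λ j → ∑[ h′ < m ] (if adj H h h′ then g (inH j h′) else 0))) ⟩
    g (inG i) + ∑[ h′ < m ] (if adj H h h′ then g (inH i h′) else 0)
      ≡⟨ cong (g (inG i) +_) (nbrSum≡sum (adj H) (g ∘ inH i) h) ⟨
    g (inG i) + nbrSum (adj H) (g ∘ inH i) h ∎
    where
    open ≡-Reasoning
    if-∧ : ∀ b c {x} → (if b ∧ c then x else 0) ≡ (if b then (if c then x else 0) else 0)
    if-∧ true  c = refl
    if-∧ false c = refl

  IsR2DF-by-cases : ∀ f → (∀ i → f (inG i) ≡ v0 → 2 ≤ nbrSum A (val ∘ f) (inG i)) →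
                    (∀ i h → f (inH i h) ≡ v0 → 2 ≤ nbrSum A (val ∘ f) (inH i h)) →
                    IsR2DF A f
  IsR2DF-by-cases f onG onH x with vertex-cases x
  ... | inj₁ (i , refl)     = onG i
  ... | inj₂ (i , h , refl) = onH i h

  blockWeight : (Fin (n + n * m) → Val) → Fin n → ℕ
  blockWeight f i = val (f (inG i)) + ∑[ h < m ] val (f (inH i h))

  weight≡sum-blockWeight : ∀ f → weight f ≡ ∑[ i < n ] blockWeight f i
  weight≡sum-blockWeight f = trans (Σv-corona (val ∘ f))
    (sym (∑-distrib-+ (val ∘ f ∘ inG) (λ i → ∑[ h < m ] val (f (inH i h)))))

  blockWeight-corona-rec : ∀ g k i →
                           blockWeight (corona-rec g k) i ≡ val (g i) + ∑[ h < m ] val (k i h)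
  blockWeight-corona-rec g k i = cong₂ _+_ (cong val (corona-rec-inG g k i))
                                           (sum-cong-≗ λ h → cong val (corona-rec-inH g k i h))

  2≤blockWeight-of-zero-in-H : ∀ {f} → IsR2DF A f → ∀ {i h} → f (inH i h) ≡ v0 →
                               2 ≤ blockWeight f i
  2≤blockWeight-of-zero-in-H {f} isR2 {i} {h} fih≡0 = begin
    2                                                     ≤⟨ isR2 (inH i h) fih≡0 ⟩
    nbrSum A (val ∘ f) (inH i h)                          ≡⟨ nbrSum-inH (val ∘ f) i h ⟩
    val (f (inG i)) + nbrSum (adj H) (val ∘ f ∘ inH i) h  ≤⟨ +-monoʳ-≤ (val (f (inG i)))
                                                               (nbrSum≤sum (adj H) _ h) ⟩
    blockWeight f i                                       ∎
    where open ≤-Reasoning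

2≤val+val-unless-v0 : ∀ x y → x ≡ v0 ⊎ y ≡ v0 ⊎ 2 ≤ val x + val y
2≤val+val-unless-v0 v0 _  = inj₁ refl
2≤val+val-unless-v0 _  v0 = inj₂ (inj₁ refl)
2≤val+val-unless-v0 v1 v1 = inj₂ (inj₂ (s≤s (s≤s z≤n)))
2≤val+val-unless-v0 v1 v2 = inj₂ (inj₂ (s≤s (s≤s z≤n)))
2≤val+val-unless-v0 v2 v1 = inj₂ (inj₂ (s≤s (s≤s z≤n)))
2≤val+val-unless-v0 v2 v2 = inj₂ (inj₂ (s≤s (s≤s z≤n)))

module Corona≥2 {n m : ℕ} (G : Graph n) (H : Graph (suc (suc m))) where
  open Corona G H

  2≤blockWeight : ∀ {f} → IsR2DF A f → ∀ i → 2 ≤ blockWeight f i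
  2≤blockWeight {f} isR2 i with 2≤val+val-unless-v0 (f (inH i zero)) (f (inH i (suc zero)))
  ... | inj₁ fi0≡0         = 2≤blockWeight-of-zero-in-H isR2 fi0≡0
  ... | inj₂ (inj₁ fi1≡0)  = 2≤blockWeight-of-zero-in-H isR2 fi1≡0
  ... | inj₂ (inj₂ 2≤sum) = ≤-trans 2≤sum
    (≤-trans (+-monoʳ-≤ (val (f (inH i zero))) (m≤m+n _ _)) (m≤n+m _ (val (f (inG i)))))

  2n≤weight : ∀ f → IsR2DF A f → 2 * n ≤ weight f
  2n≤weight f isR2 = begin
    2 * n                          ≡⟨ *-comm 2 n ⟩
    n * 2                          ≡⟨ sum-const n 2 ⟨
    ∑[ i < n ] 2                   ≤⟨ sum-mono-≤ (2≤blockWeight isR2) ⟩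
    ∑[ i < n ] blockWeight f i     ≡⟨ weight≡sum-blockWeight f ⟨
    weight f                       ∎
    where open ≤-Reasoning

  twoOnG : Fin (n + n * suc (suc m)) → Val
  twoOnG = corona-rec (λ _ → v2) (λ _ _ → v0)

  twoOnG-isR2DF : IsR2DF A twoOnG
  twoOnG-isR2DF = IsR2DF-by-cases twoOnG onG onH
    where
    onG : ∀ i → twoOnG (inG i) ≡ v0 → 2 ≤ nbrSum A (val ∘ twoOnG) (inG i)
    onG i e with () ← trans (sym (corona-rec-inG (λ _ → v2) _ i)) e
    onH : ∀ i h → twoOnG (inH i h) ≡ v0 → 2 ≤ nbrSum A (val ∘ twoOnG) (inH i h)
    onH i h _ = begin
      2                                ≡⟨ cong val (corona-rec-inG (λ _ → v2) _ i) ⟨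
      val (twoOnG (inG i))             ≤⟨ m≤m+n _ _ ⟩
      val (twoOnG (inG i)) + _         ≡⟨ nbrSum-inH (val ∘ twoOnG) i h ⟨
      nbrSum A (val ∘ twoOnG) (inH i h) ∎
      where open ≤-Reasoning

  weight-twoOnG : weight twoOnG ≡ 2 * n
  weight-twoOnG = begin
    weight twoOnG                     ≡⟨ weight≡sum-blockWeight twoOnG ⟩
    ∑[ i < n ] blockWeight twoOnG i   ≡⟨ sum-cong-≗ (λ i → trans (blockWeight-corona-rec _ _ i)
                                           (cong (2 +_) (sum-replicate-zero (suc (suc m))))) ⟩
    ∑[ i < n ] 2                      ≡⟨ sum-const n 2 ⟩
    n * 2                             ≡⟨ *-comm n 2 ⟩
    2 * n                             ∎
    where open ≡-Reasoning

  γR2≡2n : IsR2Number A (2 * n)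
  γR2≡2n = (twoOnG , twoOnG-isR2DF , weight-twoOnG) , 2n≤weight

not-0-1 : Val → Val → Bool
not-0-1 v0 v1 = false
not-0-1 _  _  = true

not-0-1≡false : ∀ a b → not-0-1 a b ≡ false → a ≡ v0 × b ≡ v1
not-0-1≡false v0 v1 _ = refl , refl

1+ind-not-0-1≤val+val : ∀ a b → (b ≡ v0 → 2 ≤ val a) →
                        1 + ind (not-0-1 a b) ≤ val a + val b
1+ind-not-0-1≤val+val v0 v0 b≡0⇒2≤a with () ← b≡0⇒2≤a refl
1+ind-not-0-1≤val+val v0 v1 _ = s≤s z≤n
1+ind-not-0-1≤val+val v0 v2 _ = s≤s (s≤s z≤n)
1+ind-not-0-1≤val+val v1 v0 b≡0⇒2≤a with s≤s () ← b≡0⇒2≤a refl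
1+ind-not-0-1≤val+val v1 v1 _ = s≤s (s≤s z≤n)
1+ind-not-0-1≤val+val v1 v2 _ = s≤s (s≤s z≤n)
1+ind-not-0-1≤val+val v2 b  _ = s≤s (s≤s z≤n)

val≤2*ind-not-0-1 : ∀ a b → val a ≤ 2 * ind (not-0-1 a b)
val≤2*ind-not-0-1 v0 b = z≤n
val≤2*ind-not-0-1 v1 b = s≤s z≤n
val≤2*ind-not-0-1 v2 b = ≤-refl

module CoronaK₁ {n : ℕ} (G : Graph n) (H : Graph 1) where
  open Corona G H

  leaf : Fin n → Fin (n + n * 1)
  leaf i = inH i zero

  nbrSum-root : ∀ g i → nbrSum A g (inG i) ≡ nbrSum (adj G) (g ∘ inG) i + g (leaf i)
  nbrSum-root g i = trans (nbrSum-inG g i) (cong (nbrSum (adj G) (g ∘ inG) i +_) (+-identityʳ _))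

  nbrSum-leaf : ∀ g i → nbrSum A g (leaf i) ≡ g (inG i)
  nbrSum-leaf g i rewrite nbrSum-inH g i zero | irrefl H zero = +-identityʳ (g (inG i))

  2≤root-of-zero-leaf : ∀ {f} → IsR2DF A f → ∀ {i} → f (leaf i) ≡ v0 →
                        2 ≤ val (f (inG i))
  2≤root-of-zero-leaf {f} isR2 {i} fℓ≡0 =
    subst (2 ≤_) (nbrSum-leaf (val ∘ f) i) (isR2 (leaf i) fℓ≡0)

  dominatingSet : (Fin (n + n * 1) → Val) → Fin n → Bool
  dominatingSet f i = not-0-1 (f (inG i)) (f (leaf i))

  dominatingSet-dominates : ∀ {f} → IsR2DF A f → IsDominating (adj G) (dominatingSet f)
  dominatingSet-dominates {f} isR2 i Si≡false
    with fi≡0 , fℓ≡1 ← not-0-1≡false _ _ Si≡false = 2≤2y+1⇒1≤y (begin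
      2                                           ≤⟨ isR2 (inG i) fi≡0 ⟩
      nbrSum A (val ∘ f) (inG i)                  ≡⟨ nbrSum-root (val ∘ f) i ⟩
      nbrSum (adj G) (val ∘ f ∘ inG) i + val (f (leaf i))
        ≡⟨ cong (λ x → nbrSum (adj G) (val ∘ f ∘ inG) i + val x) fℓ≡1 ⟩
      nbrSum (adj G) (val ∘ f ∘ inG) i + 1
        ≤⟨ +-monoˡ-≤ 1 (nbrSum-mono (adj G) val≤2*ind i) ⟩
      nbrSum (adj G) (λ j → 2 * ind (S j)) i + 1
        ≡⟨ cong (_+ 1) (nbrSum-scale (adj G) 2 (ind ∘ S) i) ⟩
      2 * nbrSum (adj G) (ind ∘ S) i + 1          ∎)
    where
    open ≤-Reasoning
    S : Fin n → Bool
    S = dominatingSet f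
    val≤2*ind : ∀ j → val (f (inG j)) ≤ 2 * ind (S j)
    val≤2*ind j = val≤2*ind-not-0-1 (f (inG j)) (f (leaf j))
    2≤2y+1⇒1≤y : ∀ {y} → 2 ≤ 2 * y + 1 → 1 ≤ y
    2≤2y+1⇒1≤y {zero}  (s≤s ())
    2≤2y+1⇒1≤y {suc y} _ = s≤s z≤n

  n+card≤weight : ∀ {f} → IsR2DF A f → n + card (dominatingSet f) ≤ weight f
  n+card≤weight {f} isR2 = begin
    n + card (dominatingSet f)                ≡⟨ sum-1+ind≡n+card (dominatingSet f) ⟨
    ∑[ i < n ] (1 + ind (dominatingSet f i))  ≤⟨ sum-mono-≤ block ⟩
    ∑[ i < n ] blockWeight f i                ≡⟨ weight≡sum-blockWeight f ⟨
    weight f                                  ∎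
    where
    open ≤-Reasoning
    block : ∀ i → 1 + ind (dominatingSet f i) ≤ blockWeight f i
    block i = ≤-trans (1+ind-not-0-1≤val+val _ _ (2≤root-of-zero-leaf isR2))
                      (≤-reflexive (cong (val (f (inG i)) +_) (sym (+-identityʳ _))))

  n+γ≤weight : ∀ {k} → IsDomNumber (adj G) k → ∀ f → IsR2DF A f → n + k ≤ weight f
  n+γ≤weight (_ , minimal) f isR2 =
    ≤-trans (+-monoʳ-≤ n (minimal _ (dominatingSet-dominates isR2))) (n+card≤weight isR2)

  rootLabel leafLabel : Bool → Val
  rootLabel b = if b then v2 else v0
  leafLabel b = if b then v0 else v1

  fromDominatingSet : (Fin n → Bool) → Fin (n + n * 1) → Val
  fromDominatingSet D = corona-rec (rootLabel ∘ D) (λ i _ → leafLabel (D i))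

  fromDominatingSet-inG : ∀ D i → fromDominatingSet D (inG i) ≡ rootLabel (D i)
  fromDominatingSet-inG D = corona-rec-inG (rootLabel ∘ D) (λ i _ → leafLabel (D i))

  fromDominatingSet-leaf : ∀ D i → fromDominatingSet D (leaf i) ≡ leafLabel (D i)
  fromDominatingSet-leaf D i = corona-rec-inH (rootLabel ∘ D) (λ i _ → leafLabel (D i)) i zero

  fromDominatingSet-isR2DF : ∀ {D} → IsDominating (adj G) D → IsR2DF A (fromDominatingSet D)
  fromDominatingSet-isR2DF {D} dom = IsR2DF-by-cases f onG onH
    where
    f : Fin (n + n * 1) → Val
    f = fromDominatingSet D
    root : ∀ {i b} → D i ≡ b → f (inG i) ≡ rootLabel b
    root {i} Di≡b = trans (fromDominatingSet-inG D i) (cong rootLabel Di≡b)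
    leafValue : ∀ {i b} → D i ≡ b → f (leaf i) ≡ leafLabel b
    leafValue {i} Di≡b = trans (fromDominatingSet-leaf D i) (cong leafLabel Di≡b)
    ind≤val : ∀ j → ind (D j) ≤ val (f (inG j))
    ind≤val j with D j in Dj
    ... | true  = subst (1 ≤_) (cong val (sym (root Dj))) (s≤s z≤n)
    ... | false = z≤n
    onG : ∀ i → f (inG i) ≡ v0 → 2 ≤ nbrSum A (val ∘ f) (inG i)
    onG i fi≡0 with D i in Di
    ... | true with () ← trans (sym (root Di)) fi≡0
    ... | false = begin
      1 + 1                                                 ≤⟨ +-monoˡ-≤ 1 (dom i Di) ⟩
      nbrSum (adj G) (ind ∘ D) i + 1
        ≤⟨ +-monoˡ-≤ 1 (nbrSum-mono (adj G) ind≤val i) ⟩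
      nbrSum (adj G) (val ∘ f ∘ inG) i + 1
        ≡⟨ cong (λ x → nbrSum (adj G) (val ∘ f ∘ inG) i + val x) (leafValue Di) ⟨
      nbrSum (adj G) (val ∘ f ∘ inG) i + val (f (leaf i))   ≡⟨ nbrSum-root (val ∘ f) i ⟨
      nbrSum A (val ∘ f) (inG i)                            ∎
      where open ≤-Reasoning
    onH : ∀ i h → f (inH i h) ≡ v0 → 2 ≤ nbrSum A (val ∘ f) (inH i h)
    onH i zero fℓ≡0 with D i in Di
    ... | false with () ← trans (sym (leafValue Di)) fℓ≡0
    ... | true = subst (2 ≤_) (sym (trans (nbrSum-leaf (val ∘ f) i) (cong val (root Di))))
                       ≤-refl

  weight-fromDominatingSet : ∀ D → weight (fromDominatingSet D) ≡ n + card D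
  weight-fromDominatingSet D = begin
    weight (fromDominatingSet D)                    ≡⟨ weight≡sum-blockWeight _ ⟩
    ∑[ i < n ] blockWeight (fromDominatingSet D) i  ≡⟨ sum-cong-≗ block ⟩
    ∑[ i < n ] (1 + ind (D i))                      ≡⟨ sum-1+ind≡n+card D ⟩
    n + card D                                      ∎
    where
    open ≡-Reasoning
    labels : ∀ b → val (rootLabel b) + (val (leafLabel b) + 0) ≡ 1 + ind b
    labels true  = refl
    labels false = refl
    block : ∀ i → blockWeight (fromDominatingSet D) i ≡ 1 + ind (D i)
    block i = trans (blockWeight-corona-rec (rootLabel ∘ D) (λ j _ → leafLabel (D j)) i)
                    (labels (D i))

  γR2≡n+γ : ∀ {k} → IsDomNumber (adj G) k → IsR2Number A (n + k)
  γR2≡n+γ γ@((D , dom , |D|≡k) , _) =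
    (fromDominatingSet D , fromDominatingSet-isR2DF dom ,
     trans (weight-fromDominatingSet D) (cong (n +_) |D|≡k)) ,
    n+γ≤weight γ

theorem3p2 : (n m : ℕ) → (G : Graph n) → (H : Graph m) → 1 ≤ m →
    (k : ℕ) → IsDomNumber (adj G) k →
    (m ≡ 1 → IsR2Number (coronaAdj G H) (n + k)) ×
    (¬ (m ≡ 1) → IsR2Number (coronaAdj G H) (2 * n))
theorem3p2 n zero          G H ()
theorem3p2 n (suc zero)    G H _ k γ =
  (λ _ → CoronaK₁.γR2≡n+γ G H γ) , (λ m≢1 → contradiction refl m≢1)
theorem3p2 n (suc (suc m)) G H _ k γ = (λ ()) , (λ _ → Corona≥2.γR2≡2n G H)
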